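{- Let $K=\mathbb{Z}_2=\{0,1\}$ and let $s\in\omega$. Let $P=\{\langle n,G_n\rangle : n\in\omega\}$ be a signaling predictor with signaler $s$, i.e. $G_s:{}^\omega K\to K$ is a function such that $G_s(f)$ does not depend on $f(s)$, for each $n\in\omega\setminus\{s\}$ the map $G_n:{}^\omega K\times K\to K$ is a function such that $G_n(f,k)$ does not depend on $f(n)$, and for every $f\in{}^\omega K$ and every $n\in\omega\setminus\{s\}$ we have $G_n(f,G_s(f))=f(n)$. Then $P$ is signal-biased: in addition, for every $f\in{}^\omega K$, all $k,l\in K$ and every $n\in\omega\setminus\{s\}$, $G_n(f,k)-G_n(f,l)=l-k$ (computed in $\mathbb{Z}_2$).
   Context: This formalizes a hat puzzle with the set $\omega$ of agents, hat colors in $K$, complete visibility, in which a designated agent $s$ (the signaler) declares first and then all other agents declare simultaneously, each having heard the signal. A coloring is a function $f\in{}^\omega K$. "$G(f)$ does not depend on $f(a)$" means $G(f)=G(g)$ (resp. $G(f,k)=G(g,k)$) whenever $f,g$ agree off $a$. -}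

module Defs where

open import Data.Nat using (ℕ)
open import Data.Fin using (Fin; zero; suc)
open import Data.Product using (_×_)
open import Relation.Binary.PropositionalEquality using (_≡_; _≢_)

K : Set
K = Fin 2

_-₂_ : K → K → K
zero -₂ zero = zero
zero -₂ suc zero = suc zero
suc zero -₂ zero = suc zero
suc zero -₂ suc zero = zero

Coloring : Set
Coloring = ℕ → K

AgreeOff : ℕ → Coloring → Coloring → Set
AgreeOff a f g = ∀ m → m ≢ a → f m ≡ g m

record SignalingPredictor (s : ℕ) (Gs : Coloring → K) (G : ℕ → Coloring → K → K) : Set where
  field
    Gs-indep : ∀ f g → AgreeOff s f g → Gs f ≡ Gs g
    G-indep  : ∀ n → n ≢ s → ∀ f g k → AgreeOff n f g → G n f k ≡ G n g k
    correct  : ∀ f n → n ≢ s → G n f (Gs f) ≡ f n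

SignalBiased : (s : ℕ) (Gs : Coloring → K) (G : ℕ → Coloring → K → K) → Set
SignalBiased s Gs G =
  SignalingPredictor s Gs G × (∀ f (k l : K) n → n ≢ s → (G n f k -₂ G n f l) ≡ (l -₂ k))

-- Recolouring agent n with c does not change what Gₙ sees of f, while the guess at the recoloured
-- signal must be c; hence k ↦ Gₙ(f, k) is onto K.  A surjective self-map of ℤ₂ is a
-- bijection, and bijections of ℤ₂ turn k - l into l - k (= k - l).
module Submission where

open import Data.Nat using (ℕ)
open import Data.Nat.Properties using (_≟_)
open import Data.Fin using (zero; suc)
open import Data.Product using (∃; _,_)
open import Function using (_∘_)
open import Relation.Nullary using (yes; no; contradiction)
open import Relation.Binary.PropositionalEquality
open ≡-Reasoning
open import Defs

update : {A : Set} → (ℕ → A) → ℕ → A → ℕ → A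
update f n c m with m ≟ n
... | yes _ = c
... | no  _ = f m

update-same : ∀ {A : Set} (f : ℕ → A) n c → update f n c n ≡ c
update-same f n c with n ≟ n
... | yes _   = refl
... | no  n≢n = contradiction refl n≢n

update-agreeOff : ∀ f n c → AgreeOff n f (update f n c)
update-agreeOff f n c m m≢n with m ≟ n
... | yes m≡n = contradiction m≡n m≢n
... | no  _   = refl

guess-surjective : ∀ {s Gs G} → SignalingPredictor s Gs G →
                   ∀ n → n ≢ s → ∀ f c → ∃ λ k → G n f k ≡ c
guess-surjective {Gs = Gs} {G} P n n≢s f c = Gs f′ , (begin
  G n f  (Gs f′) ≡⟨ G-indep n n≢s f f′ (Gs f′) (update-agreeOff f n c) ⟩
  G n f′ (Gs f′) ≡⟨ correct f′ n n≢s ⟩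
  f′ n           ≡⟨ update-same f n c ⟩
  c              ∎)
  where
    open SignalingPredictor P
    f′ = update f n c

surjective⇒distinct : (h : K → K) → (∀ c → ∃ λ k → h k ≡ c) → h zero ≢ h (suc zero)
surjective⇒distinct h surj h0≡h1 with surj zero | surj (suc zero)
... | k , hk≡0 | l , hl≡1 = contradiction (begin
  zero     ≡⟨ sym hk≡0 ⟩
  h k      ≡⟨ constant k ⟩
  h zero   ≡⟨ sym (constant l) ⟩
  h l      ≡⟨ hl≡1 ⟩
  suc zero ∎) (λ ())
  where
    constant : ∀ k → h k ≡ h zero
    constant zero       = refl
    constant (suc zero) = sym h0≡h1

-₂-self : ∀ a → a -₂ a ≡ zero
-₂-self zero       = refl
-₂-self (suc zero) = refl

-₂-distinct : ∀ a b → a ≢ b → a -₂ b ≡ suc zero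
-₂-distinct zero       zero       a≢b = contradiction refl a≢b
-₂-distinct zero       (suc zero) _   = refl
-₂-distinct (suc zero) zero       _   = refl
-₂-distinct (suc zero) (suc zero) a≢b = contradiction refl a≢b

distinct⇒-₂-swap : (h : K → K) → h zero ≢ h (suc zero) →
                   ∀ k l → h k -₂ h l ≡ l -₂ k
distinct⇒-₂-swap h _      zero       zero       = -₂-self (h zero)
distinct⇒-₂-swap h _      (suc zero) (suc zero) = -₂-self (h (suc zero))
distinct⇒-₂-swap h h0≢h1  zero       (suc zero) = -₂-distinct _ _ h0≢h1
distinct⇒-₂-swap h h0≢h1  (suc zero) zero       = -₂-distinct _ _ (h0≢h1 ∘ sym)

proposition2p3 : (s : ℕ) (Gs : Coloring → K) (G : ℕ → Coloring → K → K) →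
    SignalingPredictor s Gs G → SignalBiased s Gs G
proposition2p3 s Gs G P = P , biased
  where
    biased : ∀ f (k l : K) n → n ≢ s → (G n f k -₂ G n f l) ≡ (l -₂ k)
    biased f k l n n≢s =
      distinct⇒-₂-swap (G n f) (surjective⇒distinct (G n f) (guess-surjective P n n≢s f)) k l
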